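{- Let $G$ be a tree of order $n \ge 5$ whose complement $\overline{G}$ is connected. Then $Z(G)+Z(\overline{G})=2(n-3)$ if and only if $G$ is the graph obtained from the star $S_{n-1}=K_{1,n-2}$ by subdividing one of its edges once.
   Context: For a finite simple graph $G$, color a set $S\subseteq V(G)$ black and all other vertices white. The color-change rule: if a black vertex $u$ has exactly one white neighbor $w$, then $w$ is turned black. $S$ is a zero forcing set if repeated application of the rule eventually turns all vertices black; $Z(G)$ is the minimum size of a zero forcing set. $\overline{G}$ is the complement of $G$. $S_{n-1}=K_{1,n-2}$ is the star on $n-1$ vertices; subdividing an edge $vx$ once means replacing it by a path $v,s,x$ through a new vertex $s$. -}

module Defs where

open import Data.Nat using (ℕ; zero; suc; _+_; _<_; _≤_)
open import Data.Fin using (Fin; toℕ)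
open import Data.Fin.Subset using (Subset; _∈_; ∣_∣)
open import Data.Bool using (Bool; true; false; not; _∧_; _∨_)
open import Data.Vec using (Vec; lookup)
open import Data.Product using (Σ; _×_; ∃; ∃-syntax)
open import Relation.Binary.PropositionalEquality using (_≡_; _≢_)
open import Relation.Nullary using (¬_; does)
open import Function.Bundles using (_↔_; Inverse)
open import Function.Definitions using (Injective)
import Data.Fin as F
import Data.Nat as N

Graph : ℕ → Set
Graph n = Fin n → Fin n → Bool

Adj : ∀ {n} → Graph n → Fin n → Fin n → Set
Adj G u v = G u v ≡ true

IsSimple : ∀ {n} → Graph n → Set
IsSimple {n} G = (∀ u v → G u v ≡ G v u) × (∀ v → G v v ≡ false)

complement : ∀ {n} → Graph n → Graph n
complement G u v = not (G u v) ∧ not (does (u F.≟ v))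

data Reachable {n} (G : Graph n) (u : Fin n) : Fin n → Set where
  here : Reachable G u u
  step : ∀ {v w} → Reachable G u v → Adj G v w → Reachable G u w

Connected : ∀ {n} → Graph n → Set
Connected {n} G = ∀ (u v : Fin n) → Reachable G u v

record Cycle {n} (G : Graph n) : Set where
  field
    len      : ℕ
    len≥3    : 3 ≤ len
    vert     : Fin len → Fin n
    distinct : Injective _≡_ _≡_ vert
    adjNext  : ∀ (i : Fin len) (j : Fin len) → toℕ j ≡ suc (toℕ i) → Adj G (vert i) (vert j)
    adjWrap  : ∀ (i : Fin len) (j : Fin len) → suc (toℕ i) ≡ len → toℕ j ≡ 0 → Adj G (vert i) (vert j)

Acyclic : ∀ {n} → Graph n → Set
Acyclic G = ¬ Cycle G

IsTree : ∀ {n} → Graph n → Set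
IsTree G = IsSimple G × Connected G × Acyclic G

-- Zero forcing: the set of vertices that eventually become black when
-- starting from the black set S and repeatedly applying the color-change
-- rule (black u with exactly one white neighbour v forces v).
data Forced {n} (G : Graph n) (S : Subset n) : Fin n → Set where
  initial : ∀ {v} → v ∈ S → Forced G S v
  force   : ∀ {u v} → Forced G S u → Adj G u v →
            (∀ w → Adj G u w → w ≢ v → Forced G S w) → Forced G S v

IsZeroForcingSet : ∀ {n} → Graph n → Subset n → Set
IsZeroForcingSet G S = ∀ v → Forced G S v

IsZ : ∀ {n} → Graph n → ℕ → Set
IsZ {n} G k = (∃[ S ] (IsZeroForcingSet G S × ∣ S ∣ ≡ k))
            × (∀ (S : Subset n) → IsZeroForcingSet G S → k ≤ ∣ S ∣)

_≅_ : ∀ {n} → Graph n → Graph n → Set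
_≅_ {n} G H = Σ (Fin n ↔ Fin n) λ f →
  ∀ u v → G u v ≡ H (Inverse.to f u) (Inverse.to f v)

-- The star S_{n-1} = K_{1,n-2} with one edge subdivided once, on n vertices:
-- centre 0, subdivision vertex 1, and leaf 2 forming the path 0 – 1 – 2;
-- all other vertices 3,…,n-1 are leaves adjacent to 0.
ssEdge : ℕ → ℕ → Bool
ssEdge 0 1 = true
ssEdge 1 2 = true
ssEdge 0 (suc (suc (suc _))) = true
ssEdge _ _ = false

subdividedStar : (n : ℕ) → Graph n
subdividedStar n u v = ssEdge (toℕ u) (toℕ v) ∨ ssEdge (toℕ v) (toℕ u)

module Submission where

-- Since the complement is connected, no vertex of the tree is adjacent to all others, so the tree
-- contains an induced path a b c d. Blackening all vertices except a, b and d then gives a zero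
-- forcing set of the complement, so Z(Ḡ) ≤ n − 3; and any induced path with k edges shows
-- Z(G) ≤ n − k. A tree with an induced path on four vertices is either the subdivided star or
-- contains a path on five vertices or a double star with two leaves at each centre, and in the
-- latter cases Z(G) ≤ n − 4, so the sum falls short of 2(n − 3). For the subdivided star with centre
-- c, subdivision vertex s, far leaf ℓ and other leaves o, both numbers are exactly n − 3: every zero
-- forcing set meets every fort (a set of vertices no outside vertex neighbours exactly once), and
-- {o, o′}, {s, ℓ, o} are forts of G while {o, o′}, {c, s, ℓ, o} are forts of Ḡ.

open import Defs
open import Data.Nat using (ℕ; zero; suc; _≤_; _<_; _+_; _*_; _∸_; z≤n; s≤s)
open import Relation.Binary.PropositionalEquality using (_≡_)
open import Function.Bundles using (_⇔_; mk⇔)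

open import Data.Nat.Properties
  using (≤-trans; ≤-pred; ≤-antisym; ≤-reflexive; +-suc; +-comm; +-identityʳ; +-monoˡ-≤; +-monoʳ-≤;
         +-mono-<-≤; <⇒≢; m+n≤o⇒m≤o∸n; m+n∸n≡m; suc-injective; module ≤-Reasoning)
open import Data.Fin using (Fin; toℕ; _≟_) renaming (suc to sucF)
open import Data.Fin.Patterns using (0F; 1F; 2F; 3F)
open import Data.Fin.Properties using (any?)
open import Data.Fin.Permutation using (Permutation′; _⟨$⟩ʳ_; _⟨$⟩ˡ_; inverseˡ; inverseʳ; transpose; _∘ₚ_)
open import Data.Fin.Subset using (Subset; _∈_; _∉_; ∣_∣; ⊤; _-_; _∪_; ⁅_⁆; inside; outside)
open import Data.Fin.Subset.Properties
  using (_∈?_; ∈⊤; x∈⁅x⁆; x∈p∪q⁺; ∣⊤∣≡n; ∣⁅x⁆∣≡1; ∣p∣≤∣x∷p∣; p⊆q⇒∣p∣≤∣q∣; x∈p∧x≢y⇒x∈p-y; x∈p⇒∣p-x∣<∣p∣)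
open import Data.Bool using (Bool; true; false; _∨_) renaming (_≟_ to _≟ᵇ_)
open import Data.Bool.Properties using (¬-not)
open import Data.List using (List; []; _∷_; length)
open import Data.List.Relation.Unary.All as All using (All; []; _∷_)
open import Data.List.Relation.Unary.All.Properties using (All¬⇒¬Any; ¬All⇒Any¬)
open import Data.List.Relation.Unary.Any as Any using (Any; here; there)
open import Data.List.Relation.Unary.Any.Properties using (singleton⁻)
open import Data.List.Relation.Unary.AllPairs using ([]; _∷_)
open import Data.List.Relation.Unary.Unique.Propositional using (Unique)
open import Data.List.Membership.Propositional using () renaming (_∈_ to _∈ₗ_; _∉_ to _∉ₗ_)
open import Data.Vec as Vec using (Vec; lookup; []; _∷_)
open import Data.Vec.Relation.Unary.All using ([]; _∷_)
open import Data.Vec.Relation.Unary.AllPairs using ([]; _∷_)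
open import Data.Vec.Relation.Unary.Linked using (Linked; [-]; _∷_)
open import Data.Vec.Relation.Unary.Unique.Propositional using () renaming (Unique to UniqueVec)
open import Data.Vec.Relation.Unary.Unique.Propositional.Properties using (lookup-injective)
open import Data.Product using (_×_; _,_; proj₁; proj₂; ∃-syntax; ∃₂)
open import Data.Sum using (_⊎_; inj₁; inj₂; [_,_])
open import Relation.Nullary using (¬_; yes; no; contradiction; ¬?; _×-dec_)
open import Relation.Nullary.Decidable using (decidable-stable; dec-true; dec-false)
open import Relation.Binary.PropositionalEquality using (_≢_; ≢-sym; refl; sym; trans; cong; cong₂; subst)
open import Function using (_∘_; case_of_)

private
  variable
    n : ℕ

-- Graphs

true≢false : true ≢ false
true≢false ()

module GraphFacts (G : Graph n) where

  adj⇒¬nonadj : ∀ {u v} → Adj G u v → G u v ≢ false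
  adj⇒¬nonadj u~v u≁v = true≢false (trans (sym u~v) u≁v)

  nonadj≢adj : ∀ {w x y} → G w x ≡ false → Adj G w y → x ≢ y
  nonadj≢adj w≁x w~y refl = adj⇒¬nonadj w~y w≁x

  complement-adj⁻ : ∀ {u v} → Adj (complement G) u v → G u v ≡ false × u ≢ v
  complement-adj⁻ {u} {v} e with G u v | u ≟ v
  ... | false | no u≢v = refl , u≢v
  complement-adj⁻ () | true  | _
  complement-adj⁻ () | false | yes _

  complement-adj⁺ : ∀ {u v} → G u v ≡ false → u ≢ v → Adj (complement G) u v
  complement-adj⁺ {u} {v} u≁v u≢v rewrite u≁v with u ≟ v
  ... | yes u≡v = contradiction u≡v u≢v
  ... | no _    = refl

reachable⇒first-step : ∀ {H : Graph n} {u v} → Reachable H u v → v ≢ u → ∃[ w ] Adj H u w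
reachable⇒first-step here v≢u = contradiction refl v≢u
reachable⇒first-step {u = u} (step {v = w} r w~v) _ with w ≟ u
... | yes refl = _ , w~v
... | no w≢u   = reachable⇒first-step r w≢u

another-vertex : ∀ {m} (u : Fin (2 + m)) → ∃[ v ] (v ≢ u)
another-vertex 0F       = 1F , λ ()
another-vertex (sucF _) = 0F , λ ()

non-neighbour : ∀ {m} {G : Graph (2 + m)} → Connected (complement G) → ∀ u → ∃[ w ] (w ≢ u × G u w ≡ false)
non-neighbour {G = G} connected u with another-vertex u
... | v , v≢u with reachable⇒first-step (connected u v) v≢u
...   | w , u~ᶜw = let u≁w , u≢w = GraphFacts.complement-adj⁻ G u~ᶜw in w , ≢-sym u≢w , u≁w

reachable-cases : ∀ {G : Graph n} {u v} → Reachable G u v →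
                  v ≡ u ⊎ Adj G u v ⊎ ∃₂ λ p q → Adj G u p × Adj G p q × q ≢ u
reachable-cases here = inj₁ refl
reachable-cases {u = u} (step {v = w} {w = v} r w~v) with reachable-cases r
... | inj₁ refl             = inj₂ (inj₁ w~v)
... | inj₂ (inj₂ two-steps) = inj₂ (inj₂ two-steps)
... | inj₂ (inj₁ u~w) with v ≟ u
...   | yes v≡u = inj₁ v≡u
...   | no v≢u  = inj₂ (inj₂ (w , v , u~w , w~v , v≢u))

neighbours-within? : ∀ (G : Graph n) u ps → (∃[ r ] (Adj G u r × r ∉ₗ ps)) ⊎ (∀ r → Adj G u r → r ∈ₗ ps)
neighbours-within? G u ps with any? (λ r → (G u r ≟ᵇ true) ×-dec ¬? (Any.any? (r ≟_) ps))
... | yes (r , u~r , r∉ps) = inj₁ (r , u~r , r∉ps)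
... | no none              = inj₂ λ r u~r → decidable-stable (Any.any? (r ≟_) ps) (λ r∉ps → none (r , u~r , r∉ps))

Fin-∀-⊎ : ∀ {P : Fin n → Set} {B : Set} → (∀ i → P i ⊎ B) → (∀ i → P i) ⊎ B
Fin-∀-⊎ {zero}  _ = inj₁ λ ()
Fin-∀-⊎ {suc n} h with h 0F | Fin-∀-⊎ (h ∘ sucF)
... | inj₂ b  | _       = inj₂ b
... | inj₁ _  | inj₂ b  = inj₂ b
... | inj₁ p₀ | inj₁ ps = inj₁ λ { 0F → p₀ ; (sucF i) → ps i }

-- Counting

sum<2*[n∸3] : ∀ {n z zc} → z + 4 ≤ n → zc + 3 ≤ n → z + zc < 2 * (n ∸ 3)
sum<2*[n∸3] {n} {z} {zc} z+4≤n zc+3≤n = begin-strict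
  z + zc          <⟨ +-mono-<-≤ z<n∸3 (m+n≤o⇒m≤o∸n zc zc+3≤n) ⟩
  n ∸ 3 + (n ∸ 3) ≡⟨ cong (n ∸ 3 +_) (sym (+-identityʳ _)) ⟩
  2 * (n ∸ 3)     ∎
  where
  open ≤-Reasoning
  z<n∸3 : z < n ∸ 3
  z<n∸3 = m+n≤o⇒m≤o∸n (suc z) (≤-trans (≤-reflexive (sym (+-suc z 3))) z+4≤n)

sum≡2*[n∸3] : ∀ {n z zc} → z + 3 ≡ n → zc + 3 ≡ n → z + zc ≡ 2 * (n ∸ 3)
sum≡2*[n∸3] {n} z+3≡n zc+3≡n = cong₂ _+_ (≡n∸3 z+3≡n) (trans (≡n∸3 zc+3≡n) (sym (+-identityʳ _)))
  where
  ≡n∸3 : ∀ {x} → x + 3 ≡ n → x ≡ n ∸ 3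
  ≡n∸3 {x} eq = trans (sym (m+n∸n≡m x 3)) (cong (_∸ 3) eq)

allBut : List (Fin n) → Subset n
allBut []       = ⊤
allBut (x ∷ xs) = allBut xs - x

∉⇒∈allBut : ∀ {v} {xs : List (Fin n)} → v ∉ₗ xs → v ∈ allBut xs
∉⇒∈allBut {xs = []}     _    = ∈⊤
∉⇒∈allBut {xs = x ∷ xs} v∉xs = x∈p∧x≢y⇒x∈p-y (∉⇒∈allBut (v∉xs ∘ there)) (v∉xs ∘ here)

∣allBut∣+length≤n : ∀ {xs : List (Fin n)} → Unique xs → ∣ allBut xs ∣ + length xs ≤ n
∣allBut∣+length≤n {n} {[]}     _               = ≤-reflexive (trans (+-identityʳ _) (∣⊤∣≡n n))
∣allBut∣+length≤n {n} {x ∷ xs} (x∉xs ∷ unique) = begin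
  ∣ allBut xs - x ∣ + suc (length xs) ≡⟨ +-suc _ _ ⟩
  suc ∣ allBut xs - x ∣ + length xs   ≤⟨ +-monoˡ-≤ _ (x∈p⇒∣p-x∣<∣p∣ (∉⇒∈allBut (All¬⇒¬Any x∉xs))) ⟩
  ∣ allBut xs ∣ + length xs           ≤⟨ ∣allBut∣+length≤n unique ⟩
  n                                   ∎
  where open ≤-Reasoning

∣p∪q∣≤∣p∣+∣q∣ : (p q : Subset n) → ∣ p ∪ q ∣ ≤ ∣ p ∣ + ∣ q ∣
∣p∪q∣≤∣p∣+∣q∣ []            []            = z≤n
∣p∪q∣≤∣p∣+∣q∣ (inside ∷ p)  (b ∷ q)       = s≤s (≤-trans (∣p∪q∣≤∣p∣+∣q∣ p q) (+-monoʳ-≤ ∣ p ∣ (∣p∣≤∣x∷p∣ b q)))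
∣p∪q∣≤∣p∣+∣q∣ (outside ∷ p) (inside ∷ q)  = ≤-trans (s≤s (∣p∪q∣≤∣p∣+∣q∣ p q)) (≤-reflexive (sym (+-suc ∣ p ∣ ∣ q ∣)))
∣p∪q∣≤∣p∣+∣q∣ (outside ∷ p) (outside ∷ q) = ∣p∪q∣≤∣p∣+∣q∣ p q

∣p∪⁅x⁆∣+length≤∣p∣+length : (p : Subset n) (x : Fin n) (xs : List (Fin n)) →
                            ∣ p ∪ ⁅ x ⁆ ∣ + length xs ≤ ∣ p ∣ + length (x ∷ xs)
∣p∪⁅x⁆∣+length≤∣p∣+length p x xs = begin
  ∣ p ∪ ⁅ x ⁆ ∣ + length xs       ≤⟨ +-monoˡ-≤ _ (∣p∪q∣≤∣p∣+∣q∣ p ⁅ x ⁆) ⟩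
  ∣ p ∣ + ∣ ⁅ x ⁆ ∣ + length xs   ≡⟨ cong (λ k → ∣ p ∣ + k + length xs) (∣⁅x⁆∣≡1 x) ⟩
  ∣ p ∣ + 1 + length xs           ≡⟨ cong (_+ length xs) (+-comm ∣ p ∣ 1) ⟩
  suc ∣ p ∣ + length xs           ≡⟨ sym (+-suc _ _) ⟩
  ∣ p ∣ + suc (length xs)         ∎
  where open ≤-Reasoning

covered-by-tail : ∀ {S : Subset n} {x xs} → (∀ v → v ∉ S → v ∈ₗ x ∷ xs) → ∀ v → v ∉ S ∪ ⁅ x ⁆ → v ∈ₗ xs
covered-by-tail {x = x} covered v v∉ with covered v (v∉ ∘ x∈p∪q⁺ ∘ inj₁)
... | here refl  = contradiction (x∈p∪q⁺ (inj₂ (x∈⁅x⁆ x))) v∉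
... | there v∈xs = v∈xs

n≤∣S∣+length : (S : Subset n) (xs : List (Fin n)) → (∀ v → v ∉ S → v ∈ₗ xs) → n ≤ ∣ S ∣ + length xs
n≤∣S∣+length {n} S [] covered = begin
  n         ≡⟨ sym (∣⊤∣≡n n) ⟩
  ∣ ⊤ {n} ∣ ≤⟨ p⊆q⇒∣p∣≤∣q∣ {p = ⊤} (λ {v} _ → decidable-stable (v ∈? S) (λ v∉S → case covered v v∉S of λ ())) ⟩
  ∣ S ∣     ≡⟨ sym (+-identityʳ _) ⟩
  ∣ S ∣ + 0 ∎
  where open ≤-Reasoning
n≤∣S∣+length S (x ∷ xs) covered =
  ≤-trans (n≤∣S∣+length (S ∪ ⁅ x ⁆) xs (covered-by-tail covered)) (∣p∪⁅x⁆∣+length≤∣p∣+length S x xs)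

1+n≤∣S∣+length : (S : Subset n) (xs : List (Fin n)) → Any (_∈ S) xs → (∀ v → v ∉ S → v ∈ₗ xs) →
                 suc n ≤ ∣ S ∣ + length xs
1+n≤∣S∣+length S (x ∷ xs) (here x∈S) covered =
  ≤-trans (s≤s (n≤∣S∣+length S xs covered′)) (≤-reflexive (sym (+-suc _ _)))
  where
  covered′ : ∀ v → v ∉ S → v ∈ₗ xs
  covered′ v v∉S with covered v v∉S
  ... | here refl  = contradiction x∈S v∉S
  ... | there v∈xs = v∈xs
1+n≤∣S∣+length S (x ∷ xs) (there some∈S) covered =
  ≤-trans (1+n≤∣S∣+length (S ∪ ⁅ x ⁆) xs (Any.map (x∈p∪q⁺ ∘ inj₁) some∈S) (covered-by-tail covered))
          (∣p∪⁅x⁆∣+length≤∣p∣+length S x xs)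

-- Zero forcing

Z≤n∸ : Graph n → ℕ → Set
Z≤n∸ {n} G k = ∃[ S ] (IsZeroForcingSet G S × ∣ S ∣ + k ≤ n)

n∸≤Z : Graph n → ℕ → Set
n∸≤Z {n} G k = ∀ S → IsZeroForcingSet G S → n ≤ ∣ S ∣ + k

IsZ⇒≤ : ∀ {G : Graph n} {z k} → IsZ G z → Z≤n∸ G k → z + k ≤ n
IsZ⇒≤ (_ , minimal) (S , zfs , bound) = ≤-trans (+-monoˡ-≤ _ (minimal S zfs)) bound

IsZ⇒≥ : ∀ {G : Graph n} {z k} → IsZ G z → n∸≤Z G k → n ≤ z + k
IsZ⇒≥ ((S , zfs , refl) , _) lower = lower S zfs

allBut-black : ∀ {G : Graph n} {v xs} → All (v ≢_) xs → Forced G (allBut xs) v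
allBut-black = initial ∘ ∉⇒∈allBut ∘ All¬⇒¬Any

Fort : Graph n → List (Fin n) → Set
Fort G F = ∀ {u v} → u ∉ₗ F → v ∈ₗ F → Adj G u v → ∃[ w ] (w ∈ₗ F × w ≢ v × Adj G u w)

module _ {G : Graph n} {S : Subset n} where

  fort-unforced : ∀ {F v} → Fort G F → All (_∉ S) F → Forced G S v → v ∉ₗ F
  fort-unforced fort white (initial v∈S) v∈F = All.lookup white v∈F v∈S
  fort-unforced fort white (force u-black u~v others) v∈F
    with fort (fort-unforced fort white u-black) v∈F u~v
  ... | w , w∈F , w≢v , u~w = fort-unforced fort white (others w u~w w≢v) w∈F

  zeroForcingSet-meets-fort : ∀ {F v} → IsZeroForcingSet G S → Fort G F → v ∈ₗ F → ¬ All (_∉ S) F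
  zeroForcingSet-meets-fort zfs fort v∈F white = fort-unforced fort white (zfs _) v∈F

data InducedPath (G : Graph n) (x : Fin n) : List (Fin n) → Set where
  []   : InducedPath G x []
  step : ∀ {y zs} → Adj G x y → All (x ≢_) (y ∷ zs) → All (λ z → G x z ≡ false) zs →
         InducedPath G y zs → InducedPath G x (y ∷ zs)

inducedPath-unique : ∀ {G : Graph n} {x ys} → InducedPath G x ys → Unique (x ∷ ys)
inducedPath-unique []                   = [] ∷ []
inducedPath-unique (step _ x∉ys _ path) = x∉ys ∷ inducedPath-unique path

forced-along : ∀ {G : Graph n} {S x ys} → InducedPath G x ys → Forced G S x →
               (∀ v → v ∉ₗ ys → Forced G S v) → ∀ v → Forced G S v
forced-along [] _ off-path v = off-path v λ ()
forced-along {G = G} {S} (step {y} {zs} x~y _ x≁zs path) x-black off-path =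
  forced-along path y-black off-path′
  where
  open GraphFacts G
  y-black : Forced G S y
  y-black = force x-black x~y λ w x~w w≢y → off-path w λ
    { (here w≡y)   → w≢y w≡y
    ; (there w∈zs) → adj⇒¬nonadj x~w (All.lookup x≁zs w∈zs) }
  off-path′ : ∀ v → v ∉ₗ zs → Forced G S v
  off-path′ v v∉zs with v ≟ y
  ... | yes refl = y-black
  ... | no v≢y   = off-path v λ { (here v≡y) → v≢y v≡y ; (there v∈zs) → v∉zs v∈zs }

inducedPath⇒Z≤n∸ : ∀ {G : Graph n} {x ys} → InducedPath G x ys → Z≤n∸ G (length ys)
inducedPath⇒Z≤n∸ {ys = ys} path with inducedPath-unique path
... | x∉ys ∷ ys-unique =
  allBut ys , forced-along path (allBut-black x∉ys) (λ _ → initial ∘ ∉⇒∈allBut) , ∣allBut∣+length≤n ys-unique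

-- Blacken all but a, b, d: in the complement c forces a, then a forces d, and d forces b last.
inducedP₄⇒Z-complement≤n∸3 : ∀ {G : Graph n} {a b c d} → (∀ u v → G u v ≡ G v u) →
                               InducedPath G a (b ∷ c ∷ d ∷ []) → Z≤n∸ (complement G) 3
inducedP₄⇒Z-complement≤n∸3 {n} {G} {a} {b} {c} {d} symmetric
  (step a~b (a≢b ∷ a≢c ∷ a≢d ∷ []) (a≁c ∷ a≁d ∷ [])
    (step b~c (b≢c ∷ b≢d ∷ []) (b≁d ∷ []) (step c~d (c≢d ∷ []) [] []))) =
  S , zfs , ∣allBut∣+length≤n ((a≢b ∷ a≢d ∷ []) ∷ (b≢d ∷ []) ∷ [] ∷ [])
  where
  open GraphFacts G
  Ḡ = complement G
  S = allBut (a ∷ b ∷ d ∷ [])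
  a-black : Forced Ḡ S a
  a-black = force (allBut-black (≢-sym a≢c ∷ ≢-sym b≢c ∷ c≢d ∷ []))
                  (complement-adj⁺ (trans (symmetric c a) a≁c) (≢-sym a≢c)) λ t c~ᶜt t≢a →
    let c≁t = proj₁ (complement-adj⁻ c~ᶜt) in
    allBut-black (t≢a ∷ nonadj≢adj c≁t (trans (symmetric c b) b~c) ∷ nonadj≢adj c≁t c~d ∷ [])
  d-black : Forced Ḡ S d
  d-black = force a-black (complement-adj⁺ a≁d a≢d) λ t a~ᶜt t≢d →
    let a≁t , a≢t = complement-adj⁻ a~ᶜt in
    allBut-black (≢-sym a≢t ∷ nonadj≢adj a≁t a~b ∷ t≢d ∷ [])
  black-except-b : ∀ t → t ≢ b → Forced Ḡ S t
  black-except-b t t≢b with t ≟ a | t ≟ d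
  ... | yes refl | _        = a-black
  ... | no _     | yes refl = d-black
  ... | no t≢a   | no t≢d   = allBut-black (t≢a ∷ t≢b ∷ t≢d ∷ [])
  zfs : IsZeroForcingSet Ḡ S
  zfs v with v ≟ b
  ... | yes refl = force d-black (complement-adj⁺ (trans (symmetric d b) b≁d) (≢-sym b≢d))
                         (λ t _ → black-except-b t)
  ... | no v≢b   = black-except-b v v≢b

-- Trees

linked-lookup : ∀ {G : Graph n} {k} {xs : Vec (Fin n) k} → Linked (Adj G) xs →
                ∀ i j → toℕ j ≡ suc (toℕ i) → Adj G (lookup xs i) (lookup xs j)
linked-lookup {xs = _ ∷ _ ∷ _} (x~y ∷ _) 0F (sucF 0F) refl = x~y
linked-lookup (_ ∷ path) (sucF i) (sucF j) eq = linked-lookup path i j (suc-injective eq)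
linked-lookup (_ ∷ _) 0F 0F ()
linked-lookup (_ ∷ _) 0F (sucF (sucF _)) ()
linked-lookup (_ ∷ _) (sucF _) 0F ()
linked-lookup [-] 0F 0F ()

lookup-last : ∀ {A : Set} {k} (xs : Vec A (suc k)) i → suc (toℕ i) ≡ suc k → lookup xs i ≡ Vec.last xs
lookup-last (x ∷ [])     0F       _  = refl
lookup-last (x ∷ y ∷ ys) (sucF i) eq = lookup-last (y ∷ ys) i (suc-injective eq)

acyclic⇒¬closing-edge : ∀ {G : Graph n} {k} → Acyclic G → (xs : Vec (Fin n) (3 + k)) →
                        UniqueVec xs → Linked (Adj G) xs → ¬ Adj G (Vec.last xs) (Vec.head xs)
acyclic⇒¬closing-edge {G = G} {k} acyclic xs@(_ ∷ _) distinct path closing = acyclic record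
  { len      = 3 + k
  ; len≥3    = s≤s (s≤s (s≤s z≤n))
  ; vert     = lookup xs
  ; distinct = lookup-injective distinct _ _
  ; adjNext  = linked-lookup path
  ; adjWrap  = λ { i 0F last-i _ → subst (λ v → Adj G v (Vec.head xs)) (sym (lookup-last xs i last-i)) closing }
  }

record Path₄ (G : Graph n) : Set where
  constructor path₄
  field
    {a b c d} : Fin n
    a~b : Adj G a b
    b~c : Adj G b c
    c~d : Adj G c d
    a≢c : a ≢ c
    b≢d : b ≢ d

-- c is the centre, s the subdivision vertex and ℓ the leaf beyond it.
record SubdividedStarShape (G : Graph n) : Set where
  field
    c s ℓ  : Fin n
    c~s    : Adj G c s
    s~ℓ    : Adj G s ℓ
    c≢ℓ    : c ≢ ℓ
    nbrs-s : ∀ v → Adj G s v → v ≡ c ⊎ v ≡ ℓ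
    near   : ∀ v → v ≡ c ⊎ v ≡ s ⊎ Adj G c v ⊎ Adj G s v

starEdge : ℕ → ℕ → Bool
starEdge a b = ssEdge a b ∨ ssEdge b a

module Tree {G : Graph n} (simple : IsSimple G) (acyclic : Acyclic G) where

  open GraphFacts G

  private
    symmetric = proj₁ simple
    loopless  = proj₂ simple

  adj-sym : ∀ {u v} → Adj G u v → Adj G v u
  adj-sym {u} {v} u~v = trans (symmetric v u) u~v

  nonadj-sym : ∀ {u v} → G u v ≡ false → G v u ≡ false
  nonadj-sym {u} {v} u≁v = trans (symmetric v u) u≁v

  adj⇒≢ : ∀ {u v} → Adj G u v → u ≢ v
  adj⇒≢ {u} u~v refl = adj⇒¬nonadj u~v (loopless u)

  adj≢nonadj : ∀ {w x y} → Adj G w y → G w x ≡ false → y ≢ x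
  adj≢nonadj w~y w≁x = ≢-sym (nonadj≢adj w≁x w~y)

  walk₂⇒nonadj : ∀ {a b c} → Adj G a b → Adj G b c → G a c ≡ false
  walk₂⇒nonadj {a} {b} {c} a~b b~c with a ≟ c
  ... | yes refl = loopless a
  ... | no a≢c   = ¬-not λ a~c → acyclic⇒¬closing-edge acyclic (a ∷ b ∷ c ∷ [])
    ((adj⇒≢ a~b ∷ a≢c ∷ []) ∷ (adj⇒≢ b~c ∷ []) ∷ [] ∷ [])
    (a~b ∷ b~c ∷ [-]) (adj-sym a~c)

  walk₃⇒nonadj : ∀ {a b c d} → Adj G a b → Adj G b c → Adj G c d → a ≢ c → b ≢ d → G a d ≡ false
  walk₃⇒nonadj {a} {b} {c} {d} a~b b~c c~d a≢c b≢d with a ≟ d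
  ... | yes refl = loopless a
  ... | no a≢d   = ¬-not λ a~d → acyclic⇒¬closing-edge acyclic (a ∷ b ∷ c ∷ d ∷ [])
    ((adj⇒≢ a~b ∷ a≢c ∷ a≢d ∷ []) ∷ (adj⇒≢ b~c ∷ b≢d ∷ []) ∷ (adj⇒≢ c~d ∷ []) ∷ [] ∷ [])
    (a~b ∷ b~c ∷ c~d ∷ [-]) (adj-sym a~d)

  walk₄⇒nonadj : ∀ {a b c d e} → Adj G a b → Adj G b c → Adj G c d → Adj G d e →
                 a ≢ c → b ≢ d → c ≢ e → G a e ≡ false
  walk₄⇒nonadj {a} {b} {c} {d} {e} a~b b~c c~d d~e a≢c b≢d c≢e with a ≟ e
  ... | yes refl = loopless a
  ... | no a≢e   = ¬-not λ a~e → acyclic⇒¬closing-edge acyclic (a ∷ b ∷ c ∷ d ∷ e ∷ [])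
    ((adj⇒≢ a~b ∷ a≢c ∷ a≢d ∷ a≢e ∷ []) ∷ (adj⇒≢ b~c ∷ b≢d ∷ b≢e ∷ []) ∷
     (adj⇒≢ c~d ∷ c≢e ∷ []) ∷ (adj⇒≢ d~e ∷ []) ∷ [] ∷ [])
    (a~b ∷ b~c ∷ c~d ∷ d~e ∷ [-]) (adj-sym a~e)
    where
    a≢d = nonadj≢adj (nonadj-sym (walk₂⇒nonadj a~b b~c)) c~d
    b≢e = nonadj≢adj (nonadj-sym (walk₂⇒nonadj b~c c~d)) d~e

  path₄-induced : (P : Path₄ G) → let open Path₄ P in InducedPath G a (b ∷ c ∷ d ∷ [])
  path₄-induced (path₄ a~b b~c c~d a≢c b≢d) =
    step a~b (adj⇒≢ a~b ∷ a≢c ∷ nonadj≢adj (nonadj-sym a≁c) c~d ∷ [])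
             (a≁c ∷ walk₃⇒nonadj a~b b~c c~d a≢c b≢d ∷ [])
      (step b~c (adj⇒≢ b~c ∷ b≢d ∷ []) (walk₂⇒nonadj b~c c~d ∷ [])
        (step c~d (adj⇒≢ c~d ∷ []) [] []))
    where a≁c = walk₂⇒nonadj a~b b~c

  walk₄⇒inducedPath : ∀ {a b c d e} → Adj G a b → Adj G b c → Adj G c d → Adj G d e →
                      a ≢ c → b ≢ d → c ≢ e → InducedPath G a (b ∷ c ∷ d ∷ e ∷ [])
  walk₄⇒inducedPath a~b b~c c~d d~e a≢c b≢d c≢e =
    step a~b (adj⇒≢ a~b ∷ a≢c ∷ nonadj≢adj (nonadj-sym a≁c) c~d ∷ nonadj≢adj (nonadj-sym a≁d) d~e ∷ [])
             (a≁c ∷ a≁d ∷ walk₄⇒nonadj a~b b~c c~d d~e a≢c b≢d c≢e ∷ [])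
      (path₄-induced (path₄ b~c c~d d~e b≢d c≢e))
    where
    a≁c = walk₂⇒nonadj a~b b~c
    a≁d = walk₃⇒nonadj a~b b~c c~d a≢c b≢d

  module _ (connected : Connected G) (non-neighbour : ∀ u → ∃[ w ] (w ≢ u × G u w ≡ false)) where

    two-steps-from : ∀ u → ∃₂ λ p q → Adj G u p × Adj G p q × q ≢ u
    two-steps-from u with non-neighbour u
    ... | w , w≢u , u≁w with reachable-cases (connected u w)
    ...   | inj₁ w≡u          = contradiction w≡u w≢u
    ...   | inj₂ (inj₁ u~w)   = contradiction u≁w (adj⇒¬nonadj u~w)
    ...   | inj₂ (inj₂ steps) = steps

    -- Either a or q has a second neighbour, or both are leaves at p and two steps from p lead elsewhere.
    path₄-through : Fin n → Path₄ G
    path₄-through a with two-steps-from a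
    ... | p , q , a~p , p~q , q≢a with neighbours-within? G a (p ∷ [])
    ...   | inj₁ (r , a~r , r∉[p]) = path₄ (adj-sym a~r) a~p p~q (r∉[p] ∘ here) (≢-sym q≢a)
    ...   | inj₂ a-leaf with neighbours-within? G q (p ∷ [])
    ...     | inj₁ (s , q~s , s∉[p]) = path₄ a~p p~q q~s (≢-sym q≢a) (≢-sym (s∉[p] ∘ here))
    ...     | inj₂ q-leaf with two-steps-from p
    ...       | p′ , p″ , p~p′ , p′~p″ , p″≢p with p′ ≟ a | p′ ≟ q
    ...         | yes refl | _        = contradiction (singleton⁻ (a-leaf p″ p′~p″)) p″≢p
    ...         | no _     | yes refl = contradiction (singleton⁻ (q-leaf p″ p′~p″)) p″≢p
    ...         | no p′≢a  | no _     = path₄ a~p p~p′ p′~p″ (≢-sym p′≢a) (≢-sym p″≢p)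

  -- Blacken all but a, a₂, b, b₂: a₁ forces a, b₁ forces b, and then a forces a₂ and b forces b₂.
  doubleStar⇒Z≤n∸4 : ∀ {a b a₁ a₂ b₁ b₂} → Adj G a b → Adj G a a₁ → Adj G a a₂ → Adj G b b₁ → Adj G b b₂ →
                     a₁ ≢ a₂ → b₁ ≢ b₂ → a₁ ≢ b → a₂ ≢ b → b₁ ≢ a → b₂ ≢ a → Z≤n∸ G 4
  doubleStar⇒Z≤n∸4 {a} {b} {a₁} {a₂} {b₁} {b₂} a~b a~a₁ a~a₂ b~b₁ b~b₂ a₁≢a₂ b₁≢b₂ a₁≢b a₂≢b b₁≢a b₂≢a =
    S , zfs , ∣allBut∣+length≤n
      ((adj⇒≢ a~a₂ ∷ adj⇒≢ a~b ∷ ≢-sym b₂≢a ∷ []) ∷ (a₂≢b ∷ nonadj≢adj b≁a₂ b~b₂ ∷ []) ∷ (adj⇒≢ b~b₂ ∷ []) ∷ [] ∷ [])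
    where
    S = allBut (a ∷ a₂ ∷ b ∷ b₂ ∷ [])
    a₁~a = adj-sym a~a₁
    b₁~b = adj-sym b~b₁
    b~a  = adj-sym a~b
    b≁a₂ = walk₂⇒nonadj b~a a~a₂
    a≁b₂ = walk₂⇒nonadj a~b b~b₂
    a-black : Forced G S a
    a-black = force (allBut-black (adj⇒≢ a₁~a ∷ a₁≢a₂ ∷ a₁≢b ∷ nonadj≢adj (walk₂⇒nonadj b~a a~a₁) b~b₂ ∷ []))
                    a₁~a λ t a₁~t t≢a →
      allBut-black (t≢a ∷ adj≢nonadj a₁~t (walk₂⇒nonadj a₁~a a~a₂) ∷ adj≢nonadj a₁~t (walk₂⇒nonadj a₁~a a~b)
                        ∷ adj≢nonadj a₁~t (walk₃⇒nonadj a₁~a a~b b~b₂ a₁≢b (≢-sym b₂≢a)) ∷ [])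
    b-black : Forced G S b
    b-black = force (allBut-black (b₁≢a ∷ nonadj≢adj (walk₂⇒nonadj a~b b~b₁) a~a₂ ∷ adj⇒≢ b₁~b ∷ b₁≢b₂ ∷ []))
                    b₁~b λ t b₁~t t≢b →
      allBut-black (adj≢nonadj b₁~t (walk₂⇒nonadj b₁~b b~a)
                        ∷ adj≢nonadj b₁~t (walk₃⇒nonadj b₁~b b~a a~a₂ b₁≢a (≢-sym a₂≢b))
                        ∷ t≢b ∷ adj≢nonadj b₁~t (walk₂⇒nonadj b₁~b b~b₂) ∷ [])
    a₂-black : Forced G S a₂
    a₂-black = force a-black a~a₂ λ t a~t t≢a₂ → case t ≟ b of λ
      { (yes refl) → b-black
      ; (no t≢b)   → allBut-black (≢-sym (adj⇒≢ a~t) ∷ t≢a₂ ∷ t≢b ∷ adj≢nonadj a~t a≁b₂ ∷ []) }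
    b₂-black : Forced G S b₂
    b₂-black = force b-black b~b₂ λ t b~t t≢b₂ → case t ≟ a of λ
      { (yes refl) → a-black
      ; (no t≢a)   → allBut-black (t≢a ∷ adj≢nonadj b~t b≁a₂ ∷ ≢-sym (adj⇒≢ b~t) ∷ t≢b₂ ∷ []) }
    zfs : IsZeroForcingSet G S
    zfs v with v ≟ a | v ≟ a₂ | v ≟ b | v ≟ b₂
    ... | yes refl | _        | _        | _        = a-black
    ... | no _     | yes refl | _        | _        = a₂-black
    ... | no _     | no _     | yes refl | _        = b-black
    ... | no _     | no _     | no _     | yes refl = b₂-black
    ... | no v≢a   | no v≢a₂  | no v≢b   | no v≢b₂  = allBut-black (v≢a ∷ v≢a₂ ∷ v≢b ∷ v≢b₂ ∷ [])

  module _ (connected : Connected G) (P : Path₄ G) where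
    open Path₄ P

    Near : Fin n → Set
    Near v = v ≡ b ⊎ v ≡ c ⊎ Adj G b v ⊎ Adj G c v

    -- A vertex two steps beyond b or c, other than a and d, extends a b c d to a path on five vertices.
    near-or-Z≤n∸4 : ∀ {v} → Reachable G b v → Near v ⊎ Z≤n∸ G 4
    near-or-Z≤n∸4 here = inj₁ (inj₁ refl)
    near-or-Z≤n∸4 (step {v = v′} {w = v} r v′~v) with near-or-Z≤n∸4 r
    ... | inj₂ small              = inj₂ small
    ... | inj₁ (inj₁ refl)        = inj₁ (inj₂ (inj₂ (inj₁ v′~v)))
    ... | inj₁ (inj₂ (inj₁ refl)) = inj₁ (inj₂ (inj₂ (inj₂ v′~v)))
    ... | inj₁ (inj₂ (inj₂ (inj₁ b~v′))) with v ≟ b | v′ ≟ c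
    ...   | yes v≡b | _        = inj₁ (inj₁ v≡b)
    ...   | no _    | yes refl = inj₁ (inj₂ (inj₂ (inj₂ v′~v)))
    ...   | no v≢b  | no v′≢c  =
      inj₂ (inducedPath⇒Z≤n∸ (walk₄⇒inducedPath (adj-sym v′~v) (adj-sym b~v′) b~c c~d v≢b v′≢c b≢d))
    near-or-Z≤n∸4 (step {v = v′} {w = v} r v′~v) | inj₁ (inj₂ (inj₂ (inj₂ c~v′))) with v ≟ c | v′ ≟ b
    ...   | yes v≡c | _        = inj₁ (inj₂ (inj₁ v≡c))
    ...   | no _    | yes refl = inj₁ (inj₂ (inj₂ (inj₁ v′~v)))
    ...   | no v≢c  | no v′≢b  =
      inj₂ (inducedPath⇒Z≤n∸ (walk₄⇒inducedPath a~b b~c c~v′ v′~v a≢c (≢-sym v′≢b) (≢-sym v≢c)))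

    -- If both b and c have a neighbour off the path the tree contains a double star; otherwise the
    -- one without such a neighbour is the subdivision vertex.
    Z≤n∸4-or-shape : Z≤n∸ G 4 ⊎ SubdividedStarShape G
    Z≤n∸4-or-shape with Fin-∀-⊎ (λ v → near-or-Z≤n∸4 (connected b v))
    ... | inj₂ small = inj₁ small
    ... | inj₁ near with neighbours-within? G b (a ∷ c ∷ []) | neighbours-within? G c (b ∷ d ∷ [])
    ...   | inj₁ (x , b~x , x∉) | inj₁ (y , c~y , y∉) =
      inj₁ (doubleStar⇒Z≤n∸4 b~c (adj-sym a~b) b~x c~d c~y (≢-sym (x∉ ∘ here)) (≢-sym (y∉ ∘ there ∘ here))
                             a≢c (x∉ ∘ there ∘ here) (≢-sym b≢d) (y∉ ∘ here))
    ...   | inj₂ b-nbrs | _ = inj₂ record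
      { c = c ; s = b ; ℓ = a ; c~s = adj-sym b~c ; s~ℓ = adj-sym a~b ; c≢ℓ = ≢-sym a≢c
      ; nbrs-s = λ v b~v → case b-nbrs v b~v of λ { (here v≡a) → inj₂ v≡a ; (there (here v≡c)) → inj₁ v≡c }
      ; near   = λ v → case near v of λ
          { (inj₁ v≡b)               → inj₂ (inj₁ v≡b)
          ; (inj₂ (inj₁ v≡c))        → inj₁ v≡c
          ; (inj₂ (inj₂ (inj₁ b~v))) → inj₂ (inj₂ (inj₂ b~v))
          ; (inj₂ (inj₂ (inj₂ c~v))) → inj₂ (inj₂ (inj₁ c~v)) } }
    ...   | inj₁ _ | inj₂ c-nbrs = inj₂ record
      { c = b ; s = c ; ℓ = d ; c~s = b~c ; s~ℓ = c~d ; c≢ℓ = b≢d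
      ; nbrs-s = λ v c~v → case c-nbrs v c~v of λ { (here v≡b) → inj₁ v≡b ; (there (here v≡d)) → inj₂ v≡d }
      ; near   = near }

  module Shape (shape : SubdividedStarShape G) where
    open SubdividedStarShape shape

    Other : Fin n → Set
    Other v = v ≢ c × v ≢ s × v ≢ ℓ

    data Role : Fin n → Set where
      centre      : Role c
      subdivision : Role s
      end         : Role ℓ
      other       : ∀ {v} → Other v → Role v

    role : ∀ v → Role v
    role v with v ≟ c | v ≟ s | v ≟ ℓ
    ... | yes refl | _        | _        = centre
    ... | no _     | yes refl | _        = subdivision
    ... | no _     | no _     | yes refl = end
    ... | no v≢c   | no v≢s   | no v≢ℓ   = other (v≢c , v≢s , v≢ℓ)

    c≁ℓ : G c ℓ ≡ false
    c≁ℓ = walk₂⇒nonadj c~s s~ℓ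

    s≁other : ∀ {o} → Other o → G s o ≡ false
    s≁other (o≢c , _ , o≢ℓ) = ¬-not λ s~o → case nbrs-s _ s~o of λ
      { (inj₁ o≡c) → o≢c o≡c ; (inj₂ o≡ℓ) → o≢ℓ o≡ℓ }

    c~other : ∀ {o} → Other o → Adj G c o
    c~other {o} O@(o≢c , o≢s , _) with near o
    ... | inj₁ o≡c               = contradiction o≡c o≢c
    ... | inj₂ (inj₁ o≡s)        = contradiction o≡s o≢s
    ... | inj₂ (inj₂ (inj₁ c~o)) = c~o
    ... | inj₂ (inj₂ (inj₂ s~o)) = contradiction (s≁other O) (adj⇒¬nonadj s~o)

    ℓ≁other : ∀ {o} → Other o → G ℓ o ≡ false
    ℓ≁other O@(_ , o≢s , _) = walk₃⇒nonadj (adj-sym s~ℓ) (adj-sym c~s) (c~other O) (≢-sym c≢ℓ) (≢-sym o≢s)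

    other≁other : ∀ {o o′} → Other o → Other o′ → G o o′ ≡ false
    other≁other O O′ = walk₂⇒nonadj (adj-sym (c~other O)) (c~other O′)

    nbr-other : ∀ {u o} → Other o → Adj G u o → u ≡ c
    nbr-other {u} O u~o with role u
    ... | centre      = refl
    ... | subdivision = contradiction (s≁other O) (adj⇒¬nonadj u~o)
    ... | end         = contradiction (ℓ≁other O) (adj⇒¬nonadj u~o)
    ... | other U     = contradiction (other≁other U O) (adj⇒¬nonadj u~o)

    nbr-ℓ : ∀ {u} → Adj G u ℓ → u ≡ s
    nbr-ℓ {u} u~ℓ with role u
    ... | centre      = contradiction c≁ℓ (adj⇒¬nonadj u~ℓ)
    ... | subdivision = refl
    ... | end         = contradiction (loopless ℓ) (adj⇒¬nonadj u~ℓ)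
    ... | other U     = contradiction (nonadj-sym (ℓ≁other U)) (adj⇒¬nonadj u~ℓ)

    RankOf : ∀ {v} → Role v → ℕ → Set
    RankOf centre      a = a ≡ 0
    RankOf subdivision a = a ≡ 1
    RankOf end         a = a ≡ 2
    RankOf (other _)   a = ∃[ j ] (a ≡ 3 + j)

    adjacency-by-rank : ∀ {u v a b} (ru : Role u) (rv : Role v) → RankOf ru a → RankOf rv b →
                        G u v ≡ starEdge a b
    adjacency-by-rank centre      centre      refl       refl       = loopless c
    adjacency-by-rank centre      subdivision refl       refl       = c~s
    adjacency-by-rank centre      end         refl       refl       = c≁ℓ
    adjacency-by-rank centre      (other V)   refl       (_ , refl) = c~other V
    adjacency-by-rank subdivision centre      refl       refl       = adj-sym c~s
    adjacency-by-rank subdivision subdivision refl       refl       = loopless s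
    adjacency-by-rank subdivision end         refl       refl       = s~ℓ
    adjacency-by-rank subdivision (other V)   refl       (_ , refl) = s≁other V
    adjacency-by-rank end         centre      refl       refl       = nonadj-sym c≁ℓ
    adjacency-by-rank end         subdivision refl       refl       = adj-sym s~ℓ
    adjacency-by-rank end         end         refl       refl       = loopless ℓ
    adjacency-by-rank end         (other V)   refl       (_ , refl) = ℓ≁other V
    adjacency-by-rank (other U)   centre      (_ , refl) refl       = adj-sym (c~other U)
    adjacency-by-rank (other U)   subdivision (_ , refl) refl       = nonadj-sym (s≁other U)
    adjacency-by-rank (other U)   end         (_ , refl) refl       = nonadj-sym (ℓ≁other U)
    adjacency-by-rank (other U)   (other V)   (_ , refl) (_ , refl) = other≁other U V

    fort-others : ∀ {o₁ o₂} → Other o₁ → Other o₂ → o₁ ≢ o₂ → Fort G (o₁ ∷ o₂ ∷ [])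
    fort-others O₁ O₂ o₁≢o₂ _ (here refl) u~o₁ with nbr-other O₁ u~o₁
    ... | refl = _ , there (here refl) , ≢-sym o₁≢o₂ , c~other O₂
    fort-others O₁ O₂ o₁≢o₂ _ (there (here refl)) u~o₂ with nbr-other O₂ u~o₂
    ... | refl = _ , here refl , o₁≢o₂ , c~other O₁

    fort-sℓo : ∀ {o} → Other o → Fort G (s ∷ ℓ ∷ o ∷ [])
    fort-sℓo O@(_ , o≢s , _) u∉ (here refl) u~s with nbrs-s _ (adj-sym u~s)
    ... | inj₁ refl = _ , there (there (here refl)) , o≢s , c~other O
    ... | inj₂ u≡ℓ  = contradiction (there (here u≡ℓ)) u∉
    fort-sℓo O u∉ (there (here refl)) u~ℓ = contradiction (here (nbr-ℓ u~ℓ)) u∉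
    fort-sℓo O@(_ , o≢s , _) u∉ (there (there (here refl))) u~o with nbr-other O u~o
    ... | refl = _ , here refl , ≢-sym o≢s , c~s

    private
      Ḡ = complement G

    ≁other⇒≁other : ∀ {u o o′} → Other o → Other o′ → G u o ≡ false → G u o′ ≡ false
    ≁other⇒≁other O O′ u≁o = ¬-not λ u~o′ → case nbr-other O′ u~o′ of λ
      { refl → adj⇒¬nonadj (c~other O) u≁o }

    fort-others-complement : ∀ {o₁ o₂} → Other o₁ → Other o₂ → o₁ ≢ o₂ → Fort Ḡ (o₁ ∷ o₂ ∷ [])
    fort-others-complement O₁ O₂ o₁≢o₂ u∉ (here refl) u~ᶜo₁ =
      _ , there (here refl) , ≢-sym o₁≢o₂ ,
      complement-adj⁺ (≁other⇒≁other O₁ O₂ (proj₁ (complement-adj⁻ u~ᶜo₁))) (u∉ ∘ there ∘ here)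
    fort-others-complement O₁ O₂ o₁≢o₂ u∉ (there (here refl)) u~ᶜo₂ =
      _ , here refl , o₁≢o₂ ,
      complement-adj⁺ (≁other⇒≁other O₂ O₁ (proj₁ (complement-adj⁻ u~ᶜo₂))) (u∉ ∘ here)

    fort-csℓo-complement : ∀ {o} → Other o → Fort Ḡ (c ∷ s ∷ ℓ ∷ o ∷ [])
    fort-csℓo-complement {o} O@(_ , o≢s , o≢ℓ) {u} u∉ = witness
      where
      U : Other u
      U = u∉ ∘ here , u∉ ∘ there ∘ here , u∉ ∘ there ∘ there ∘ here
      u~ᶜo : Adj Ḡ u o
      u~ᶜo = complement-adj⁺ (other≁other U O) (u∉ ∘ there ∘ there ∘ there ∘ here)
      witness : ∀ {v} → v ∈ₗ c ∷ s ∷ ℓ ∷ o ∷ [] → Adj Ḡ u v → ∃[ w ] (w ∈ₗ c ∷ s ∷ ℓ ∷ o ∷ [] × w ≢ v × Adj Ḡ u w)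
      witness (here refl) u~ᶜc = contradiction (proj₁ (complement-adj⁻ u~ᶜc)) (adj⇒¬nonadj (adj-sym (c~other U)))
      witness (there (here refl))                 _ = o , there (there (there (here refl))) , o≢s , u~ᶜo
      witness (there (there (here refl)))         _ = o , there (there (there (here refl))) , o≢ℓ , u~ᶜo
      witness (there (there (there (here refl)))) _ =
        s , there (here refl) , ≢-sym o≢s , complement-adj⁺ (nonadj-sym (s≁other U)) (proj₁ (proj₂ U))

    n≤∣S∣+3 : ∀ S → (∀ {o₁ o₂} → Other o₁ → Other o₂ → o₁ ≢ o₂ → ¬ All (_∉ S) (o₁ ∷ o₂ ∷ [])) →
              (∀ {o} → Other o → ¬ All (_∉ S) (c ∷ s ∷ ℓ ∷ o ∷ [])) → n ≤ ∣ S ∣ + 3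
    n≤∣S∣+3 S ¬two-others ¬four with any? (λ v → (¬? (v ≟ c) ×-dec ¬? (v ≟ s) ×-dec ¬? (v ≟ ℓ)) ×-dec ¬? (v ∈? S))
    ... | no none = n≤∣S∣+length S (c ∷ s ∷ ℓ ∷ []) covered
      where
      covered : ∀ v → v ∉ S → v ∈ₗ c ∷ s ∷ ℓ ∷ []
      covered v v∉S with role v
      ... | centre      = here refl
      ... | subdivision = there (here refl)
      ... | end         = there (there (here refl))
      ... | other V     = contradiction (v , V , v∉S) none
    ... | yes (o , O , o∉S) =
      ≤-pred (≤-trans (1+n≤∣S∣+length S (c ∷ s ∷ ℓ ∷ o ∷ []) some-black covered) (≤-reflexive (+-suc _ 3)))
      where
      some-black : Any (_∈ S) (c ∷ s ∷ ℓ ∷ o ∷ [])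
      some-black = Any.map (λ {v} → decidable-stable (v ∈? S)) (¬All⇒Any¬ (λ v → ¬? (v ∈? S)) _ (¬four O))
      covered : ∀ v → v ∉ S → v ∈ₗ c ∷ s ∷ ℓ ∷ o ∷ []
      covered v v∉S with role v
      ... | centre      = here refl
      ... | subdivision = there (here refl)
      ... | end         = there (there (here refl))
      ... | other V with v ≟ o
      ...   | yes v≡o = there (there (there (here v≡o)))
      ...   | no v≢o  = contradiction (v∉S ∷ o∉S ∷ []) (¬two-others V O v≢o)

    n∸3≤Z : n∸≤Z G 3
    n∸3≤Z S zfs = n≤∣S∣+3 S
      (λ O₁ O₂ o₁≢o₂ → zeroForcingSet-meets-fort zfs (fort-others O₁ O₂ o₁≢o₂) (here refl))
      (λ O white → zeroForcingSet-meets-fort zfs (fort-sℓo O) (here refl) (All.tail white))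

    n∸3≤Z-complement : n∸≤Z Ḡ 3
    n∸3≤Z-complement S zfs = n≤∣S∣+3 S
      (λ O₁ O₂ o₁≢o₂ → zeroForcingSet-meets-fort zfs (fort-others-complement O₁ O₂ o₁≢o₂) (here refl))
      (λ O → zeroForcingSet-meets-fort zfs (fort-csℓo-complement O) (here refl))

    Z≤n∸3 : ∀ {o} → Other o → Z≤n∸ G 3
    Z≤n∸3 O@(_ , o≢s , _) = inducedPath⇒Z≤n∸ (path₄-induced (path₄ (adj-sym (c~other O)) c~s s~ℓ o≢s c≢ℓ))

-- Recognising the subdivided star

transpose-maps : ∀ (i j : Fin n) → transpose i j ⟨$⟩ʳ i ≡ j
transpose-maps i j rewrite dec-true (i ≟ i) refl = refl

transpose-fixes : ∀ {i j k : Fin n} → k ≢ i → k ≢ j → transpose i j ⟨$⟩ʳ k ≡ k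
transpose-fixes {i = i} {j} {k} k≢i k≢j rewrite dec-false (k ≟ i) k≢i | dec-false (k ≟ j) k≢j = refl

⟨$⟩ʳ-injective : ∀ (π : Permutation′ n) {x y} → π ⟨$⟩ʳ x ≡ π ⟨$⟩ʳ y → x ≡ y
⟨$⟩ʳ-injective π eq = trans (sym (inverseˡ π)) (trans (cong (π ⟨$⟩ˡ_) eq) (inverseˡ π))

three-point-transitive : ∀ {x y z i j k : Fin n} → x ≢ y → x ≢ z → y ≢ z → i ≢ j → i ≢ k → j ≢ k →
                         ∃[ π ] (π ⟨$⟩ʳ x ≡ i × π ⟨$⟩ʳ y ≡ j × π ⟨$⟩ʳ z ≡ k)
three-point-transitive {x = x} {y} {z} {i} {j} {k} x≢y x≢z y≢z i≢j i≢k j≢k =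
  π₁ ∘ₚ π₂ ∘ₚ π₃ , πx≡i , πy≡j , transpose-maps z₂ k
  where
  π₁ = transpose x i
  y₁ = π₁ ⟨$⟩ʳ y
  π₂ = transpose y₁ j
  z₂ = π₂ ⟨$⟩ʳ (π₁ ⟨$⟩ʳ z)
  π₃ = transpose z₂ k
  π₁x≡i : π₁ ⟨$⟩ʳ x ≡ i
  π₁x≡i = transpose-maps x i
  π₂i≡i : π₂ ⟨$⟩ʳ i ≡ i
  π₂i≡i = transpose-fixes (λ i≡y₁ → x≢y (⟨$⟩ʳ-injective π₁ (trans π₁x≡i i≡y₁))) i≢j
  z₂≢i : z₂ ≢ i
  z₂≢i z₂≡i = x≢z (⟨$⟩ʳ-injective π₁ (⟨$⟩ʳ-injective π₂ (trans (cong (π₂ ⟨$⟩ʳ_) π₁x≡i) (trans π₂i≡i (sym z₂≡i)))))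
  z₂≢j : z₂ ≢ j
  z₂≢j z₂≡j = y≢z (⟨$⟩ʳ-injective π₁ (⟨$⟩ʳ-injective π₂ (trans (transpose-maps y₁ j) (sym z₂≡j))))
  πx≡i : π₃ ⟨$⟩ʳ (π₂ ⟨$⟩ʳ (π₁ ⟨$⟩ʳ x)) ≡ i
  πx≡i = trans (cong (λ v → π₃ ⟨$⟩ʳ (π₂ ⟨$⟩ʳ v)) π₁x≡i)
               (trans (cong (π₃ ⟨$⟩ʳ_) π₂i≡i) (transpose-fixes (≢-sym z₂≢i) i≢k))
  πy≡j : π₃ ⟨$⟩ʳ (π₂ ⟨$⟩ʳ y₁) ≡ j
  πy≡j = trans (cong (π₃ ⟨$⟩ʳ_) (transpose-maps y₁ j)) (transpose-fixes (≢-sym z₂≢j) j≢k)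

toℕ≥3 : ∀ {m} (i : Fin (3 + m)) → i ≢ 0F → i ≢ 1F → i ≢ 2F → ∃[ j ] (toℕ i ≡ 3 + j)
toℕ≥3 0F                     i≢0 _   _   = contradiction refl i≢0
toℕ≥3 1F                     _   i≢1 _   = contradiction refl i≢1
toℕ≥3 2F                     _   _   i≢2 = contradiction refl i≢2
toℕ≥3 (sucF (sucF (sucF i))) _   _   _   = toℕ i , refl

module _ {m} {G : Graph (3 + m)} (simple : IsSimple G) (acyclic : Acyclic G) (shape : SubdividedStarShape G) where
  open SubdividedStarShape shape
  open Tree simple acyclic
  open Shape shape

  -- Send c, s, ℓ to 0, 1, 2; the remaining vertices then land on the other leaves 3, 4, … of the star.
  shape⇒≅ : G ≅ subdividedStar (3 + m)
  shape⇒≅ with three-point-transitive {i = 0F} {1F} {2F} (adj⇒≢ c~s) c≢ℓ (adj⇒≢ s~ℓ) (λ ()) (λ ()) (λ ())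
  ... | π , πc , πs , πℓ = π , λ u v → adjacency-by-rank (role u) (role v) (rank (role u)) (rank (role v))
    where
    rank : ∀ {v} (r : Role v) → RankOf r (toℕ (π ⟨$⟩ʳ v))
    rank centre      = cong toℕ πc
    rank subdivision = cong toℕ πs
    rank end         = cong toℕ πℓ
    rank (other (v≢c , v≢s , v≢ℓ)) = toℕ≥3 (π ⟨$⟩ʳ _)
      (λ e → v≢c (⟨$⟩ʳ-injective π (trans e (sym πc))))
      (λ e → v≢s (⟨$⟩ʳ-injective π (trans e (sym πs))))
      (λ e → v≢ℓ (⟨$⟩ʳ-injective π (trans e (sym πℓ))))

module FromIsomorphism {m} {G : Graph (4 + m)} (iso : G ≅ subdividedStar (4 + m)) where

  private
    open GraphFacts G

    π = proj₁ iso

    from : Fin (4 + m) → Fin (4 + m)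
    from = π ⟨$⟩ˡ_

    from-injective : ∀ {i j} → from i ≡ from j → i ≡ j
    from-injective eq = trans (sym (inverseʳ π)) (trans (cong (π ⟨$⟩ʳ_) eq) (inverseʳ π))

    adj-from : ∀ i j → G (from i) (from j) ≡ starEdge (toℕ i) (toℕ j)
    adj-from i j = trans (proj₂ iso (from i) (from j))
                         (cong₂ (λ x y → starEdge (toℕ x) (toℕ y)) (inverseʳ π) (inverseʳ π))

    by-image : (P : Fin (4 + m) → Set) → (∀ i → P (from i)) → ∀ v → P v
    by-image P h v = subst P (inverseˡ π) (h (π ⟨$⟩ʳ v))

  shape : SubdividedStarShape G
  shape = record
    { c = from 0F ; s = from 1F ; ℓ = from 2F
    ; c~s    = adj-from 0F 1F
    ; s~ℓ    = adj-from 1F 2F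
    ; c≢ℓ    = λ eq → case from-injective eq of λ ()
    ; nbrs-s = by-image _ nbrs-s′
    ; near   = by-image _ near′
    }
    where
    nbrs-s′ : ∀ i → Adj G (from 1F) (from i) → from i ≡ from 0F ⊎ from i ≡ from 2F
    nbrs-s′ 0F                       _   = inj₁ refl
    nbrs-s′ 1F                       s~s = contradiction (adj-from 1F 1F) (adj⇒¬nonadj s~s)
    nbrs-s′ 2F                       _   = inj₂ refl
    nbrs-s′ i@(sucF (sucF (sucF _))) s~v = contradiction (adj-from 1F i) (adj⇒¬nonadj s~v)
    near′ : ∀ i → from i ≡ from 0F ⊎ from i ≡ from 1F ⊎ Adj G (from 0F) (from i) ⊎ Adj G (from 1F) (from i)
    near′ 0F                       = inj₁ refl
    near′ 1F                       = inj₂ (inj₁ refl)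
    near′ 2F                       = inj₂ (inj₂ (inj₂ (adj-from 1F 2F)))
    near′ i@(sucF (sucF (sucF _))) = inj₂ (inj₂ (inj₁ (adj-from 0F i)))

  open SubdividedStarShape shape

  o : Fin (4 + m)
  o = from 3F

  o≢c,s,ℓ : o ≢ c × o ≢ s × o ≢ ℓ
  o≢c,s,ℓ = (λ eq → case from-injective eq of λ ()) , (λ eq → case from-injective eq of λ ())
          , (λ eq → case from-injective eq of λ ())

corollary4p6 : (n : ℕ) → 5 ≤ n → (G : Graph n) → IsTree G → Connected (complement G) →
    (z zc : ℕ) → IsZ G z → IsZ (complement G) zc →
    ((z + zc ≡ 2 * (n ∸ 3)) ⇔ (G ≅ subdividedStar n))
corollary4p6 .(5 + m) (s≤s (s≤s (s≤s (s≤s (s≤s {n = m} _))))) G (simple , connected , acyclic) co-connected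
             z zc Zz Zzc = mk⇔ forward backward
  where
  open Tree simple acyclic
  P : Path₄ G
  P = path₄-through connected (non-neighbour co-connected) 0F
  zc+3≤n : zc + 3 ≤ 5 + m
  zc+3≤n = IsZ⇒≤ Zzc (inducedP₄⇒Z-complement≤n∸3 (proj₁ simple) (path₄-induced P))
  forward : z + zc ≡ 2 * (5 + m ∸ 3) → G ≅ subdividedStar (5 + m)
  forward sum = [ (λ small → contradiction sum (<⇒≢ (sum<2*[n∸3] (IsZ⇒≤ Zz small) zc+3≤n)))
                , shape⇒≅ simple acyclic ] (Z≤n∸4-or-shape connected P)
  backward : G ≅ subdividedStar (5 + m) → z + zc ≡ 2 * (5 + m ∸ 3)
  backward iso = sum≡2*[n∸3] (≤-antisym (IsZ⇒≤ Zz (Z≤n∸3 o≢c,s,ℓ)) (IsZ⇒≥ Zz n∸3≤Z))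
                             (≤-antisym zc+3≤n (IsZ⇒≥ Zzc n∸3≤Z-complement))
    where
    open FromIsomorphism iso
    open Shape shape
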